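{- Let $G$ be a graph and $F$ a forest, both on $n$ vertices, such that $G$ and $F$ do not pack, $F$ is edge-minimal with this property (for every edge $e$ of $F$, $G$ and $F-e$ pack), $3\Delta(G)+\ell^*(F)=n$, and $\Delta(G)>1$. Let $u'$ be a leaf of $F$, $x'$ its neighbor in $F$, and let $f:V(G)\to V(F)$ be a quasipacking of $G$ with $F$ with $f(u)=u'$, $f(x)=x'$ and conflicting edge $ux$. Then: 1. $N_G[u]=N_G[x]$; 2. with $Q=N_G[u]$, the induced subgraph $G[Q]$ is a complete graph and is a connected component of $G$.
   Context: All graphs are finite and simple; $\Delta(G)$ is the maximum degree and $N_G[v]=N_G(v)\cup\{v\}$ is the closed neighborhood. Graphs $G,F$ on $n$ vertices pack if there is a bijection $f:V(G)\to V(F)$ with $f(u)f(v)\notin E(F)$ for all $uv\in E(G)$. For a forest $F$, $\ell^*(F)=\sum_{v\in V(F)}\max\{\deg_F(v)-2,0\}$. For a bijection $f:V(G)\to V(F)$, its multigraph has vertex set $V(G)$, a "$G$-edge" $uv$ for each $uv\in E(G)$, and an "$F$-edge" $uv$ for each pair with $f(u)f(v)\in E(F)$. A quasipacking of $G$ with $F$ is a bijection $f$ whose multigraph has exactly one pair of vertices joined by both a $G$-edge and an $F$-edge (and is otherwise simple); that pair is the conflicting edge. -}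

module Defs where

open import Data.Nat using (ℕ; zero; suc; _+_; _∸_; _⊔_; _≤_)
open import Data.Fin using (Fin; _≟_)
open import Data.Bool using (Bool; true; false; T; if_then_else_)
open import Data.Bool.Properties using (T?)
open import Data.List using (List; []; _∷_; map; foldr; allFin; length; filter)
open import Data.Nat.ListAction using (sum)
open import Data.List.Relation.Unary.Unique.Propositional using (Unique)
open import Data.Product using (Σ; _×_; _,_)
open import Data.Sum using (_⊎_)
open import Relation.Binary.PropositionalEquality using (_≡_)
open import Relation.Nullary using (¬_; does)
open import Function.Definitions using (Bijective)

record Graph (n : ℕ) : Set where
  field
    adj   : Fin n → Fin n → Bool
    sym   : ∀ u v → adj u v ≡ adj v u
    irrefl : ∀ v → adj v v ≡ false
open Graph public

_∼[_]_ : ∀ {n} → Fin n → Graph n → Fin n → Set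
u ∼[ G ] v = T (adj G u v)

deg : ∀ {n} → Graph n → Fin n → ℕ
deg {n} G v = length (filter (λ w → T? (adj G v w)) (allFin n))

Δ : ∀ {n} → Graph n → ℕ
Δ {n} G = foldr _⊔_ 0 (map (deg G) (allFin n))

ℓ* : ∀ {n} → Graph n → ℕ
ℓ* {n} F = sum (map (λ v → deg F v ∸ 2) (allFin n))

data Path {n} (G : Graph n) : List (Fin n) → Set where
  single : ∀ v → Path G (v ∷ [])
  step   : ∀ u v vs → u ∼[ G ] v → Path G (v ∷ vs) → Path G (u ∷ v ∷ vs)

last : ∀ {A : Set} → A → List A → A
last a [] = a
last a (b ∷ bs) = last b bs

record Cycle {n} (G : Graph n) : Set where
  field
    v₀    : Fin n
    rest  : List (Fin n)
    long  : 2 ≤ length rest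
    uniq  : Unique (v₀ ∷ rest)
    path  : Path G (v₀ ∷ rest)
    close : last v₀ rest ∼[ G ] v₀

Forest : ∀ {n} → Graph n → Set
Forest G = ¬ Cycle G

private
  isPair : ∀ {n} → Fin n → Fin n → Fin n → Fin n → Bool
  isPair a b u v =
    (does (u ≟ a) Data.Bool.∧ does (v ≟ b)) Data.Bool.∨ (does (u ≟ b) Data.Bool.∧ does (v ≟ a))

deleteEdge : ∀ {n} → Graph n → Fin n → Fin n → Graph n
deleteEdge F a b = record
  { adj = λ u v → adj F u v Data.Bool.∧ Data.Bool.not (isPair a b u v)
  ; sym = symProof
  ; irrefl = λ v → cong (λ z → z Data.Bool.∧ Data.Bool.not (isPair a b v v)) (Graph.irrefl F v) }
  where
  open import Data.Bool.Properties using (∧-zeroʳ; ∨-comm)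
  open import Relation.Binary.PropositionalEquality using (cong₂; refl; sym; trans; cong)
  import Data.Bool.Properties
  isPair-sym : ∀ u v → isPair a b u v ≡ isPair a b v u
  isPair-sym u v with u ≟ a | v ≟ b | u ≟ b | v ≟ a
  ... | p | q | r | s with does p | does q | does r | does s
  ... | true  | true  | true  | true  = refl
  ... | true  | true  | true  | false = refl
  ... | true  | true  | false | true  = refl
  ... | true  | true  | false | false = refl
  ... | true  | false | true  | true  = refl
  ... | true  | false | true  | false = refl
  ... | true  | false | false | true  = refl
  ... | true  | false | false | false = refl
  ... | false | true  | true  | true  = refl
  ... | false | true  | true  | false = refl
  ... | false | true  | false | true  = refl
  ... | false | true  | false | false = refl
  ... | false | false | true  | true  = refl
  ... | false | false | true  | false = refl
  ... | false | false | false | true  = refl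
  ... | false | false | false | false = refl
  symProof : ∀ u v → _
  symProof u v = cong₂ Data.Bool._∧_ (Graph.sym F u v) (cong Data.Bool.not (isPair-sym u v))

PackingMap : ∀ {n} → Graph n → Graph n → (Fin n → Fin n) → Set
PackingMap G F f = Bijective _≡_ _≡_ f × (∀ u v → u ∼[ G ] v → ¬ (f u ∼[ F ] f v))

Packs : ∀ {n} → Graph n → Graph n → Set
Packs G F = Σ (Fin _ → Fin _) (PackingMap G F)

EdgeMinimalNonPacking : ∀ {n} → Graph n → Graph n → Set
EdgeMinimalNonPacking G F = ¬ Packs G F × (∀ a b → a ∼[ F ] b → Packs G (deleteEdge F a b))

QuasipackingWithConflict : ∀ {n} → Graph n → Graph n → (Fin n → Fin n) → Fin n → Fin n → Set
QuasipackingWithConflict G F f a b =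
  Bijective _≡_ _≡_ f × a ∼[ G ] b × f a ∼[ F ] f b ×
  (∀ c d → c ∼[ G ] d → f c ∼[ F ] f d → (c ≡ a × d ≡ b) ⊎ (c ≡ b × d ≡ a))

N[_]_ : ∀ {n} → Graph n → Fin n → Fin n → Set
N[ G ] v = λ w → w ≡ v ⊎ v ∼[ G ] w

CompleteOn : ∀ {n} → Graph n → (Fin n → Set) → Set
CompleteOn G Q = ∀ a b → Q a → Q b → ¬ a ≡ b → a ∼[ G ] b

data WalkIn {n} (G : Graph n) (Q : Fin n → Set) : Fin n → Fin n → Set where
  here : ∀ a → Q a → WalkIn G Q a a
  next : ∀ a b c → Q a → a ∼[ G ] b → WalkIn G Q b c → WalkIn G Q a c

IsComponent : ∀ {n} → Graph n → (Fin n → Set) → Set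
IsComponent {n} G Q =
  Σ (Fin n) Q × (∀ a b → Q a → Q b → WalkIn G Q a b) × (∀ a b → Q a → a ∼[ G ] b → Q b)

module Submission where

-- Let the quasipacking h have conflicting edge pq, with h p a leaf of F whose neighbour is h q.
-- If w ∉ N[q], transposing p and w in h removes every conflict unless h w has an F-neighbour in
-- h(N(p)); as G and F do not pack, it has one. So the list h(N[q]) followed by the F-neighbourhoods
-- of h(N(p)) covers V(F). Its length is at most 1 + Δ + 2Δ + ℓ*(F) = n + 1 (vertices of degree < 2
-- only make it shorter), and h p occurs in it twice: so no other vertex occurs twice and h maps N(p)
-- to non-leaves. The same holds for the quasipacking h ∘ (p q), with p and q exchanged. If N[p] ≠ N[q],
-- these facts allow an endless non-backtracking walk in F through the images of N(p) ∖ N[q],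
-- N(q) ∖ N[p] and of vertices outside both, which is impossible in a forest. Finally, any other
-- neighbour a of p takes the place of p in the quasipacking h ∘ (p a), so all vertices of N[p]
-- have the same closed neighbourhood, which is therefore a clique and a component.

open import Defs hiding (sym)
open import Data.Empty using (⊥; ⊥-elim)
open import Data.Bool using (T; if_then_else_)
open import Data.Bool.Properties using (T?)
open import Data.Fin using (Fin; _≟_)
open import Data.Fin.Properties using (any?)
open import Data.Fin.Permutation.Components using (transpose)
import Data.Fin.Permutation as Permutation
open import Data.List using (List; []; _∷_; _++_; map; filter; length; allFin; concatMap; foldr)
open import Data.List.Properties using (map-cong; map-++; length-map; length-++; length-tabulate)
open import Data.List.Membership.Propositional using (_∈_; _∉_)
open import Data.List.Membership.Propositional.Properties using (∈-allFin; ∈-filter⁺; ∈-filter⁻; ∈-map⁺)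
open import Data.List.Relation.Unary.Any using (here; there)
open import Data.List.Relation.Unary.All as All using (All)
open import Data.List.Relation.Unary.All.Properties using (¬Any⇒All¬; All¬⇒¬Any)
open import Data.List.Relation.Unary.AllPairs using ([]; _∷_)
open import Data.List.Relation.Unary.Unique.Propositional using (Unique)
import Data.List.Relation.Unary.Unique.Propositional.Properties as Unique
open import Data.Nat using (ℕ; zero; suc; _+_; _*_; _∸_; _⊔_; _≤_; _<_; z≤n; s≤s)
open import Data.Nat.Properties hiding (_≟_)
open import Algebra.Properties.CommutativeSemigroup +-commutativeSemigroup using (interchange)
open import Data.Nat.ListAction using (sum)
open import Data.Nat.ListAction.Properties using (sum-++)
open import Data.Product as Product using (_×_; _,_; proj₁; proj₂; ∃-syntax)
open import Data.Sum as Sum using (_⊎_; inj₁; inj₂; [_,_])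
open import Function using (_∘_; id)
open import Function.Definitions using (Bijective; Injective)
open import Function.Bundles using (Bijection)
open import Function.Properties.Inverse using (↔⇒⤖)
import Function.Construct.Composition as Composition
open import Relation.Binary.PropositionalEquality using (_≡_; _≢_; refl; sym; trans; cong; cong₂; subst; subst₂; module ≡-Reasoning)
open import Relation.Nullary using (¬_; Dec; yes; no; does)
open import Relation.Nullary.Decidable using (dec-true; dec-false; _×-dec_; _⊎-dec_; toSum; decidable-stable)
open import Relation.Unary using (_⊆′_)

∑ : {A : Set} → (A → ℕ) → List A → ℕ
∑ f xs = sum (map f xs)

module _ {A : Set} where

  ∑-cong : ∀ {f g : A → ℕ} → (∀ x → f x ≡ g x) → ∀ xs → ∑ f xs ≡ ∑ g xs
  ∑-cong f≗g xs = cong sum (map-cong f≗g xs)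

  ∑-+ : ∀ (f g : A → ℕ) xs → ∑ (λ x → f x + g x) xs ≡ ∑ f xs + ∑ g xs
  ∑-+ f g []       = refl
  ∑-+ f g (x ∷ xs) = trans (cong (f x + g x +_) (∑-+ f g xs)) (interchange (f x) (g x) _ _)

  ∑-const : ∀ c (xs : List A) → ∑ (λ _ → c) xs ≡ c * length xs
  ∑-const c []       = sym (*-zeroʳ c)
  ∑-const c (x ∷ xs) = trans (cong (c +_) (∑-const c xs)) (sym (*-suc c (length xs)))

  ∑-++ : ∀ (f : A → ℕ) xs ys → ∑ f (xs ++ ys) ≡ ∑ f xs + ∑ f ys
  ∑-++ f xs ys = trans (cong sum (map-++ f xs ys)) (sum-++ (map f xs) (map f ys))

  ∑-concatMap : ∀ {B : Set} (f : A → ℕ) (g : B → List A) xs →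
    ∑ f (concatMap g xs) ≡ ∑ (λ b → ∑ f (g b)) xs
  ∑-concatMap f g []       = refl
  ∑-concatMap f g (x ∷ xs) = trans (∑-++ f (g x) (concatMap g xs)) (cong (∑ f (g x) +_) (∑-concatMap f g xs))

  ∑-mono : ∀ {f g : A → ℕ} xs → (∀ x → f x ≤ g x) → ∑ f xs ≤ ∑ g xs
  ∑-mono []       f≤g = z≤n
  ∑-mono (x ∷ xs) f≤g = +-mono-≤ (f≤g x) (∑-mono xs f≤g)

  ∑-≥-term : ∀ (f : A → ℕ) {xs a} → a ∈ xs → f a ≤ ∑ f xs
  ∑-≥-term f {x ∷ xs} (here refl) = m≤m+n (f x) _
  ∑-≥-term f {x ∷ xs} (there a∈xs) = ≤-trans (∑-≥-term f a∈xs) (m≤n+m _ (f x))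

  ∑-≥-two-terms : ∀ (f : A → ℕ) {xs a b} → a ∈ xs → b ∈ xs → a ≢ b → f a + f b ≤ ∑ f xs
  ∑-≥-two-terms f (here refl) (here refl) a≢b = ⊥-elim (a≢b refl)
  ∑-≥-two-terms f {x ∷ _} (here refl) (there b∈xs) _ = +-monoʳ-≤ (f x) (∑-≥-term f b∈xs)
  ∑-≥-two-terms f {x ∷ _} {a} (there a∈xs) (here refl) _ =
    ≤-trans (≤-reflexive (+-comm (f a) (f x))) (+-monoʳ-≤ (f x) (∑-≥-term f a∈xs))
  ∑-≥-two-terms f {x ∷ _} (there a∈xs) (there b∈xs) a≢b =
    ≤-trans (∑-≥-two-terms f a∈xs b∈xs a≢b) (m≤n+m _ (f x))

  ∑-∸1 : ∀ (c : A → ℕ) → (∀ x → 1 ≤ c x) → ∀ xs → ∑ c xs ≡ length xs + ∑ (λ x → c x ∸ 1) xs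
  ∑-∸1 c 1≤c xs = begin
    ∑ c xs                                     ≡⟨ ∑-cong (λ x → sym (m+[n∸m]≡n (1≤c x))) xs ⟩
    ∑ (λ x → 1 + (c x ∸ 1)) xs                 ≡⟨ ∑-+ (λ _ → 1) (λ x → c x ∸ 1) xs ⟩
    ∑ (λ _ → 1) xs + ∑ (λ x → c x ∸ 1) xs      ≡⟨ cong (_+ ∑ (λ x → c x ∸ 1) xs) (trans (∑-const 1 xs) (*-identityˡ _)) ⟩
    length xs + ∑ (λ x → c x ∸ 1) xs           ∎
    where open ≡-Reasoning

length-concatMap : ∀ {A B : Set} (g : A → List B) xs → length (concatMap g xs) ≡ ∑ (length ∘ g) xs
length-concatMap g []       = refl
length-concatMap g (x ∷ xs) = trans (length-++ (g x)) (cong (length (g x) +_) (length-concatMap g xs))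

module _ {n : ℕ} where

  δ : Fin n → Fin n → ℕ
  δ v z = if does (v ≟ z) then 1 else 0

  δ-refl : ∀ v → δ v v ≡ 1
  δ-refl v rewrite dec-true (v ≟ v) refl = refl

  δ-≢ : ∀ {v z} → v ≢ z → δ v z ≡ 0
  δ-≢ {v} {z} v≢z rewrite dec-false (v ≟ z) v≢z = refl

  multiplicity : Fin n → List (Fin n) → ℕ
  multiplicity v = ∑ (δ v)

  multiplicity-∈ : ∀ {v xs} → v ∈ xs → 1 ≤ multiplicity v xs
  multiplicity-∈ {v} {xs} v∈xs = subst (_≤ multiplicity v xs) (δ-refl v) (∑-≥-term (δ v) v∈xs)

  multiplicity-∉ : ∀ {v xs} → v ∉ xs → multiplicity v xs ≡ 0
  multiplicity-∉ {xs = []}    _    = refl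
  multiplicity-∉ {xs = x ∷ _} v∉xs = cong₂ _+_ (δ-≢ (v∉xs ∘ here)) (multiplicity-∉ (v∉xs ∘ there))

  multiplicity-unique : ∀ v {xs} → Unique xs → multiplicity v xs ≤ 1
  multiplicity-unique v {[]}     []           = z≤n
  multiplicity-unique v {x ∷ xs} (x∉xs ∷ uxs) with v ≟ x
  ... | yes refl = ≤-reflexive (cong suc (multiplicity-∉ (All¬⇒¬Any x∉xs)))
  ... | no  _    = multiplicity-unique v uxs

  ∑-δ*-∉ : ∀ (φ : Fin n → ℕ) {z xs} → z ∉ xs → ∑ (λ v → δ v z * φ v) xs ≡ 0
  ∑-δ*-∉ φ {xs = []}    _    = refl
  ∑-δ*-∉ φ {xs = x ∷ _} z∉xs rewrite δ-≢ (λ x≡z → z∉xs (here (sym x≡z))) = ∑-δ*-∉ φ (z∉xs ∘ there)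

  ∑-δ*-unique : ∀ (φ : Fin n → ℕ) {z xs} → Unique xs → z ∈ xs → ∑ (λ v → δ v z * φ v) xs ≡ φ z
  ∑-δ*-unique φ {z} (x∉xs ∷ _) (here refl)
    rewrite δ-refl z | ∑-δ*-∉ φ (All¬⇒¬Any x∉xs) = trans (+-identityʳ _) (+-identityʳ _)
  ∑-δ*-unique φ (x∉xs ∷ uxs) (there z∈xs) rewrite δ-≢ (All.lookup x∉xs z∈xs) = ∑-δ*-unique φ uxs z∈xs

  ∑-by-multiplicity : ∀ (φ : Fin n → ℕ) L → ∑ φ L ≡ ∑ (λ v → multiplicity v L * φ v) (allFin n)
  ∑-by-multiplicity φ []      = sym (∑-const 0 (allFin n))
  ∑-by-multiplicity φ (z ∷ L) = begin
    φ z + ∑ φ L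
      ≡⟨ cong₂ _+_ (sym (∑-δ*-unique φ (Unique.allFin⁺ n) (∈-allFin z))) (∑-by-multiplicity φ L) ⟩
    ∑ (λ v → δ v z * φ v) (allFin n) + ∑ (λ v → multiplicity v L * φ v) (allFin n)
      ≡⟨ sym (∑-+ _ _ (allFin n)) ⟩
    ∑ (λ v → δ v z * φ v + multiplicity v L * φ v) (allFin n)
      ≡⟨ ∑-cong (λ v → sym (*-distribʳ-+ (φ v) (δ v z) (multiplicity v L))) (allFin n) ⟩
    ∑ (λ v → multiplicity v (z ∷ L) * φ v) (allFin n)
      ∎
    where open ≡-Reasoning

  ∑-multiplicity : ∀ L → ∑ (λ v → multiplicity v L) (allFin n) ≡ length L
  ∑-multiplicity L = begin
    ∑ (λ v → multiplicity v L) (allFin n)      ≡⟨ ∑-cong (λ v → sym (*-identityʳ _)) (allFin n) ⟩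
    ∑ (λ v → multiplicity v L * 1) (allFin n)  ≡⟨ sym (∑-by-multiplicity (λ _ → 1) L) ⟩
    ∑ (λ _ → 1) L                              ≡⟨ trans (∑-const 1 L) (*-identityˡ _) ⟩
    length L                                   ∎
    where open ≡-Reasoning

  ∑-unique≤∑-allFin : ∀ (φ : Fin n → ℕ) {L} → Unique L → ∑ φ L ≤ ∑ φ (allFin n)
  ∑-unique≤∑-allFin φ {L} uL = begin
    ∑ φ L                                          ≡⟨ ∑-by-multiplicity φ L ⟩
    ∑ (λ v → multiplicity v L * φ v) (allFin n)    ≤⟨ ∑-mono (allFin n) (λ v → *-monoˡ-≤ (φ v) (multiplicity-unique v uL)) ⟩
    ∑ (λ v → 1 * φ v) (allFin n)                   ≡⟨ ∑-cong (λ v → *-identityˡ (φ v)) (allFin n) ⟩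
    ∑ φ (allFin n)                                 ∎
    where open ≤-Reasoning

  length-allFin : length (allFin n) ≡ n
  length-allFin = length-tabulate (λ i → i)

  unique⇒length≤ : ∀ {L} → Unique L → length L ≤ n
  unique⇒length≤ {L} uL = begin
    length L                 ≡⟨ sym (trans (∑-const 1 L) (*-identityˡ _)) ⟩
    ∑ (λ _ → 1) L            ≤⟨ ∑-unique≤∑-allFin (λ _ → 1) uL ⟩
    ∑ (λ _ → 1) (allFin n)   ≡⟨ trans (∑-const 1 (allFin n)) (trans (*-identityˡ _) length-allFin) ⟩
    n                        ∎
    where open ≤-Reasoning

  covering-length : ∀ L → (∀ v → 1 ≤ multiplicity v L) →
    length L ≡ n + ∑ (λ v → multiplicity v L ∸ 1) (allFin n)
  covering-length L covers = begin
    length L                                         ≡⟨ sym (∑-multiplicity L) ⟩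
    ∑ (λ v → multiplicity v L) (allFin n)            ≡⟨ ∑-∸1 (λ v → multiplicity v L) covers (allFin n) ⟩
    length (allFin n) + ∑ (λ v → multiplicity v L ∸ 1) (allFin n)
                                                     ≡⟨ cong (_+ ∑ (λ v → multiplicity v L ∸ 1) (allFin n)) length-allFin ⟩
    n + ∑ (λ v → multiplicity v L ∸ 1) (allFin n)    ∎
    where open ≡-Reasoning

module _ {n : ℕ} (H : Graph n) where

  neighbours : Fin n → List (Fin n)
  neighbours v = filter (λ w → T? (adj H v w)) (allFin n)

  ∈-neighbours⁺ : ∀ {v w} → v ∼[ H ] w → w ∈ neighbours v
  ∈-neighbours⁺ {v} {w} v∼w = ∈-filter⁺ (λ w → T? (adj H v w)) (∈-allFin w) v∼w

  ∈-neighbours⁻ : ∀ {v w} → w ∈ neighbours v → v ∼[ H ] w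
  ∈-neighbours⁻ {v} w∈ = proj₂ (∈-filter⁻ (λ w → T? (adj H v w)) {xs = allFin n} w∈)

  neighbours-unique : ∀ v → Unique (neighbours v)
  neighbours-unique v = Unique.filter⁺ (λ w → T? (adj H v w)) (Unique.allFin⁺ n)

  ∼-sym : ∀ {u v} → u ∼[ H ] v → v ∼[ H ] u
  ∼-sym {u} {v} = subst T (Graph.sym H u v)

  ∼⇒≢ : ∀ {u v} → u ∼[ H ] v → u ≢ v
  ∼⇒≢ {u} u∼u refl = subst T (irrefl H u) u∼u

  adjacent? : ∀ u v → Dec (u ∼[ H ] v)
  adjacent? u v = T? (adj H u v)

  closed-neighbourhood? : ∀ v w → Dec ((N[ H ] v) w)
  closed-neighbourhood? v w = (w ≟ v) ⊎-dec adjacent? v w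

  deg≤Δ : ∀ v → deg H v ≤ Δ H
  deg≤Δ v = ≤-foldr-⊔ (∈-map⁺ (deg H) (∈-allFin v))
    where
    ≤-foldr-⊔ : ∀ {xs k} → k ∈ xs → k ≤ foldr _⊔_ 0 xs
    ≤-foldr-⊔ {x ∷ _} (here refl)  = m≤m⊔n x _
    ≤-foldr-⊔ {x ∷ _} (there k∈xs) = ≤-trans (≤-foldr-⊔ k∈xs) (m≤n⊔m x _)

  leaf-neighbour-unique : ∀ {v a b} → deg H v ≡ 1 → v ∼[ H ] a → v ∼[ H ] b → a ≡ b
  leaf-neighbour-unique {v} deg≡1 v∼a v∼b = singleton (neighbours v) deg≡1 (∈-neighbours⁺ v∼a) (∈-neighbours⁺ v∼b)
    where
    singleton : ∀ (xs : List (Fin n)) {a b} → length xs ≡ 1 → a ∈ xs → b ∈ xs → a ≡ b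
    singleton (_ ∷ []) _ (here refl) (here refl) = refl

  neighbour-avoiding : ∀ {v} → 2 ≤ deg H v → ∀ z → ∃[ w ] v ∼[ H ] w × w ≢ z
  neighbour-avoiding {v} 2≤deg z with pick (neighbours v) (neighbours-unique v) 2≤deg
    where
    pick : ∀ xs → Unique xs → 2 ≤ length xs → ∃[ w ] w ∈ xs × w ≢ z
    pick (a ∷ b ∷ _) ((a≢b All.∷ _) ∷ _) _ with a ≟ z
    ... | yes refl = b , there (here refl) , a≢b ∘ sym
    ... | no  a≢z  = a , here refl , a≢z
    pick (_ ∷ []) _ (s≤s ())
  ... | w , w∈ , w≢z = w , ∈-neighbours⁻ w∈ , w≢z

  private
    m+[2∸m]≡2+[m∸2] : ∀ m → m + (2 ∸ m) ≡ 2 + (m ∸ 2)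
    m+[2∸m]≡2+[m∸2] 0             = refl
    m+[2∸m]≡2+[m∸2] 1             = refl
    m+[2∸m]≡2+[m∸2] (suc (suc m)) = cong (suc ∘ suc) (trans (cong (m +_) (0∸n≡0 m)) (+-identityʳ m))

  ∑-deg+∑-deficit≤ : ∀ {xs} → Unique xs → ∑ (deg H) xs + ∑ (λ v → 2 ∸ deg H v) xs ≤ 2 * length xs + ℓ* H
  ∑-deg+∑-deficit≤ {xs} uxs = begin
    ∑ (deg H) xs + ∑ (λ v → 2 ∸ deg H v) xs     ≡⟨ sym (∑-+ (deg H) (λ v → 2 ∸ deg H v) xs) ⟩
    ∑ (λ v → deg H v + (2 ∸ deg H v)) xs        ≡⟨ ∑-cong (λ v → m+[2∸m]≡2+[m∸2] (deg H v)) xs ⟩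
    ∑ (λ v → 2 + (deg H v ∸ 2)) xs              ≡⟨ ∑-+ (λ _ → 2) (λ v → deg H v ∸ 2) xs ⟩
    ∑ (λ _ → 2) xs + ∑ (λ v → deg H v ∸ 2) xs   ≡⟨ cong (_+ ∑ (λ v → deg H v ∸ 2) xs) (∑-const 2 xs) ⟩
    2 * length xs + ∑ (λ v → deg H v ∸ 2) xs    ≤⟨ +-monoʳ-≤ (2 * length xs) (∑-unique≤∑-allFin (λ v → deg H v ∸ 2) uxs) ⟩
    2 * length xs + ℓ* H                        ∎
    where open ≤-Reasoning

pullback : ∀ {n} → Graph n → (Fin n → Fin n) → Graph n
pullback F h = record
  { adj    = λ a b → adj F (h a) (h b)
  ; sym    = λ a b → Graph.sym F (h a) (h b)
  ; irrefl = λ a → irrefl F (h a) }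

module _ {n : ℕ} (F : Graph n) {h : Fin n → Fin n} (h-injective : Injective _≡_ _≡_ h) where

  private
    map-path : ∀ xs → Path (pullback F h) xs → Path F (map h xs)
    map-path (v ∷ [])     (single _)           = single (h v)
    map-path (u ∷ v ∷ vs) (step _ _ _ u∼v vs′) = step (h u) (h v) (map h vs) u∼v (map-path (v ∷ vs) vs′)

    last-map : ∀ z xs → last (h z) (map h xs) ≡ h (last z xs)
    last-map z []       = refl
    last-map z (y ∷ ys) = last-map y ys

  map-cycle : Cycle (pullback F h) → Cycle F
  map-cycle c = record
    { v₀    = h v₀
    ; rest  = map h rest
    ; long  = subst (2 ≤_) (sym (length-map h rest)) long
    ; uniq  = Unique.map⁺ h-injective uniq
    ; path  = map-path (v₀ ∷ rest) path
    ; close = subst (_∼[ F ] h v₀) (sym (last-map v₀ rest)) close }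
    where open Cycle c

module _ {n : ℕ} where

  private
    takeThrough : ∀ {x : Fin n} xs → x ∈ xs → List (Fin n)
    takeThrough (y ∷ _)  (here _)  = y ∷ []
    takeThrough (y ∷ ys) (there i) = y ∷ takeThrough ys i

    takeThrough-nonempty : ∀ {x : Fin n} xs (i : x ∈ xs) → 1 ≤ length (takeThrough xs i)
    takeThrough-nonempty (_ ∷ _) (here _)  = s≤s z≤n
    takeThrough-nonempty (_ ∷ _) (there _) = s≤s z≤n

    last-takeThrough : ∀ {x : Fin n} z xs (i : x ∈ xs) → last z (takeThrough xs i) ≡ x
    last-takeThrough z (_ ∷ _)  (here refl) = refl
    last-takeThrough z (y ∷ ys) (there i)   = last-takeThrough y ys i

    takeThrough-all : ∀ {P : Fin n → Set} {x} xs (i : x ∈ xs) → All P xs → All P (takeThrough xs i)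
    takeThrough-all (_ ∷ _)  (here _)  (p All.∷ _)  = p All.∷ All.[]
    takeThrough-all (_ ∷ ys) (there i) (p All.∷ ps) = p All.∷ takeThrough-all ys i ps

    takeThrough-unique : ∀ {x} xs (i : x ∈ xs) → Unique xs → Unique (takeThrough xs i)
    takeThrough-unique (_ ∷ _)  (here _)  (_ ∷ _)       = All.[] ∷ []
    takeThrough-unique (_ ∷ ys) (there i) (y∉ys ∷ uys) = takeThrough-all ys i y∉ys ∷ takeThrough-unique ys i uys

    takeThrough-path : ∀ {G : Graph n} {x} v xs (i : x ∈ xs) → Path G (v ∷ xs) → Path G (v ∷ takeThrough xs i)
    takeThrough-path v (y ∷ _)  (here _)  (step _ _ _ v∼y _)   = step v y [] v∼y (single y)
    takeThrough-path v (y ∷ ys) (there i) (step _ _ _ v∼y ys′) = step v y (takeThrough ys i) v∼y (takeThrough-path y ys i ys′)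

  module _ (F : Graph n) (K : Fin n → Fin n → Set) (K⇒∼ : ∀ {v w} → K v w → v ∼[ F ] w)
           (extend : ∀ {w v} → K w v → ∃[ w′ ] K v w′ × w′ ≢ w) where
    open import Data.List.Membership.DecPropositional (_≟_ {n}) using (_∈?_)

    private
      -- a ∷ b ∷ ws is the walk so far, latest vertex first; it stays duplicate-free, so it cannot
      -- outgrow Fin n.
      walk : (fuel : ℕ) (a b : Fin n) (ws : List (Fin n)) → K b a → Unique (a ∷ b ∷ ws) →
        Path F (a ∷ b ∷ ws) → n < fuel + length (a ∷ b ∷ ws) → Cycle F
      walk fuel a b ws b→a u p n< with extend b→a
      ... | w′ , a→w′ , w′≢b with w′ ∈? (a ∷ b ∷ ws)
      ... | yes (here w′≡a)         = ⊥-elim (∼⇒≢ F (K⇒∼ a→w′) (sym w′≡a))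
      ... | yes (there (here w′≡b)) = ⊥-elim (w′≢b w′≡b)
      ... | yes (there (there i))   = record
        { v₀    = a
        ; rest  = b ∷ takeThrough ws i
        ; long  = s≤s (takeThrough-nonempty ws i)
        ; uniq  = takeThrough-unique (a ∷ b ∷ ws) (there (there i)) u
        ; path  = takeThrough-path a (b ∷ ws) (there i) p
        ; close = subst (_∼[ F ] a) (sym (last-takeThrough b ws i)) (∼-sym F (K⇒∼ a→w′)) }
      walk zero a b ws b→a u p n< | _ , _ , _ | no _ = ⊥-elim (<⇒≱ n< (unique⇒length≤ u))
      walk (suc fuel) a b ws b→a u p n< | w′ , a→w′ , _ | no w′∉ =
        walk fuel w′ a (b ∷ ws) a→w′ (¬Any⇒All¬ _ w′∉ ∷ u) (step w′ a (b ∷ ws) (∼-sym F (K⇒∼ a→w′)) p)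
             (≤-trans n< (≤-reflexive (sym (+-suc fuel _))))

    nonBacktracking⇒Cycle : ∀ {v w} → K v w → Cycle F
    nonBacktracking⇒Cycle {v} {w} v→w =
      walk n w v [] v→w (((∼⇒≢ F (K⇒∼ v→w) ∘ sym) All.∷ All.[]) ∷ All.[] ∷ [])
           (step w v [] (∼-sym F (K⇒∼ v→w)) (single v)) (≤-trans (n≤1+n (suc n)) (≤-reflexive (+-comm 2 n)))

data TransposeView {n} (i j k : Fin n) : Fin n → Set where
  at-i      : k ≡ i → TransposeView i j k j
  at-j      : k ≢ i → k ≡ j → TransposeView i j k i
  elsewhere : k ≢ i → k ≢ j → TransposeView i j k k

transpose-view : ∀ {n} (i j k : Fin n) → TransposeView i j k (transpose i j k)
transpose-view i j k with k ≟ i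
... | yes k≡i = at-i k≡i
... | no  k≢i with k ≟ j
...   | yes k≡j = at-j k≢i k≡j
...   | no  k≢j = elsewhere k≢i k≢j

module _ {n} (i j : Fin n) where

  transpose-i : transpose i j i ≡ j
  transpose-i with transpose i j i | transpose-view i j i
  ... | _ | at-i _          = refl
  ... | _ | at-j i≢i _      = ⊥-elim (i≢i refl)
  ... | _ | elsewhere i≢i _ = ⊥-elim (i≢i refl)

  transpose-j : transpose i j j ≡ i
  transpose-j with transpose i j j | transpose-view i j j
  ... | _ | at-i j≡i        = j≡i
  ... | _ | at-j _ _        = refl
  ... | _ | elsewhere _ j≢j = ⊥-elim (j≢j refl)

  transpose-elsewhere : ∀ {k} → k ≢ i → k ≢ j → transpose i j k ≡ k
  transpose-elsewhere {k} k≢i k≢j with transpose i j k | transpose-view i j k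
  ... | _ | at-i k≡i      = ⊥-elim (k≢i k≡i)
  ... | _ | at-j _ k≡j    = ⊥-elim (k≢j k≡j)
  ... | _ | elsewhere _ _ = refl

  transpose-involutive : ∀ k → transpose i j (transpose i j k) ≡ k
  transpose-involutive k with transpose i j k | transpose-view i j k
  ... | _ | at-i k≡i          = trans transpose-j (sym k≡i)
  ... | _ | at-j _ k≡j        = trans transpose-i (sym k≡j)
  ... | _ | elsewhere k≢i k≢j = transpose-elsewhere k≢i k≢j

  ∘transpose-bijective : ∀ {h : Fin n → Fin n} → Bijective _≡_ _≡_ h → Bijective _≡_ _≡_ (h ∘ transpose i j)
  ∘transpose-bijective = Composition.bijective _≡_ _≡_ _≡_ (Bijection.bijective (↔⇒⤖ (Permutation.transpose i j)))

module _ {n : ℕ} (G F : Graph n) (¬packs : ¬ Packs G F) (tight : 3 * Δ G + ℓ* F ≡ n) where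

  module LeafConflict (h : Fin n → Fin n) (p q : Fin n) (qp : QuasipackingWithConflict G F h p q)
                      (leaf : deg F (h p) ≡ 1) where

    h-bijective : Bijective _≡_ _≡_ h
    h-bijective = proj₁ qp

    h-injective : Injective _≡_ _≡_ h
    h-injective = proj₁ h-bijective

    h⁻¹ : Fin n → Fin n
    h⁻¹ y = proj₁ (proj₂ h-bijective y)

    h∘h⁻¹ : ∀ y → h (h⁻¹ y) ≡ y
    h∘h⁻¹ y = proj₂ (proj₂ h-bijective y) refl

    p∼q : p ∼[ G ] q
    p∼q = proj₁ (proj₂ qp)

    hp∼hq : h p ∼[ F ] h q
    hp∼hq = proj₁ (proj₂ (proj₂ qp))

    only-conflict : ∀ c d → c ∼[ G ] d → h c ∼[ F ] h d → (c ≡ p × d ≡ q) ⊎ (c ≡ q × d ≡ p)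
    only-conflict = proj₂ (proj₂ (proj₂ qp))

    p≢q : p ≢ q
    p≢q = ∼⇒≢ G p∼q

    hp∼h⇒≡q : ∀ {w} → h p ∼[ F ] h w → w ≡ q
    hp∼h⇒≡q hp∼hw = h-injective (leaf-neighbour-unique F leaf hp∼hw hp∼hq)

    F-neighbour-avoiding : ∀ {v} → 2 ≤ deg F (h v) → ∀ w → ∃[ v′ ] h v ∼[ F ] h v′ × v′ ≢ w
    F-neighbour-avoiding {v} 2≤deg w with neighbour-avoiding F 2≤deg (h w)
    ... | z , hv∼z , z≢hw =
      h⁻¹ z , subst (h v ∼[ F ]_) (sym (h∘h⁻¹ z)) hv∼z , λ h⁻¹z≡w → z≢hw (trans (sym (h∘h⁻¹ z)) (cong h h⁻¹z≡w))

    TransposedConflict : Fin n → Fin n → Fin n → Set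
    TransposedConflict w c d =
      (c ≡ p × d ≡ w × w ≡ q) ⊎ (c ≡ w × d ≡ q) ⊎ (c ≡ p × p ∼[ G ] d × h w ∼[ F ] h d)

    -- Since h p is a leaf with neighbour h q, the only new conflicts of h ∘ (p w) involve p or w.
    transposed-conflict : ∀ w c d → c ∼[ G ] d → h (transpose p w c) ∼[ F ] h (transpose p w d) →
      TransposedConflict w c d ⊎ TransposedConflict w d c
    transposed-conflict w c d c∼d conflict
      with transpose p w c | transpose-view p w c | transpose p w d | transpose-view p w d
    ... | _ | at-i c≡p       | _ | at-i d≡p       = ⊥-elim (∼⇒≢ G c∼d (trans c≡p (sym d≡p)))
    ... | _ | at-i c≡p       | _ | at-j _ d≡w     = inj₁ (inj₁ (c≡p , d≡w , hp∼h⇒≡q (∼-sym F conflict)))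
    ... | _ | at-i c≡p       | _ | elsewhere _ _  = inj₁ (inj₂ (inj₂ (c≡p , subst (_∼[ G ] d) c≡p c∼d , conflict)))
    ... | _ | at-j _ c≡w     | _ | at-i d≡p       = inj₂ (inj₁ (d≡p , c≡w , hp∼h⇒≡q conflict))
    ... | _ | at-j _ c≡w     | _ | at-j _ d≡w     = ⊥-elim (∼⇒≢ G c∼d (trans c≡w (sym d≡w)))
    ... | _ | at-j _ c≡w     | _ | elsewhere _ _  = inj₁ (inj₂ (inj₁ (c≡w , hp∼h⇒≡q conflict)))
    ... | _ | elsewhere _ _  | _ | at-i d≡p       =
      inj₂ (inj₂ (inj₂ (d≡p , subst (_∼[ G ] c) d≡p (∼-sym G c∼d) , ∼-sym F conflict)))
    ... | _ | elsewhere _ _  | _ | at-j _ d≡w     = inj₂ (inj₂ (inj₁ (d≡w , hp∼h⇒≡q (∼-sym F conflict))))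
    ... | _ | elsewhere c≢p _ | _ | elsewhere d≢p _ with only-conflict c d c∼d conflict
    ...   | inj₁ (c≡p , _) = ⊥-elim (c≢p c≡p)
    ...   | inj₂ (_ , d≡p) = ⊥-elim (d≢p d≡p)

    -- Otherwise h ∘ (p w) would pack G with F.
    outside-N[q]⇒F-adjacent-to-N⟨p⟩ : ∀ {w} → ¬ (N[ G ] q) w → ∃[ a ] p ∼[ G ] a × h w ∼[ F ] h a
    outside-N[q]⇒F-adjacent-to-N⟨p⟩ {w} w∉N[q] with any? (λ a → adjacent? G p a ×-dec adjacent? F (h w) (h a))
    ... | yes found = found
    ... | no  none  = ⊥-elim (¬packs (h ∘ transpose p w , ∘transpose-bijective p w h-bijective , packs))
      where
      impossible : ∀ {c d} → c ∼[ G ] d → ¬ TransposedConflict w c d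
      impossible _   (inj₁ (_ , _ , w≡q))          = w∉N[q] (inj₁ w≡q)
      impossible c∼d (inj₂ (inj₁ (c≡w , d≡q)))      = w∉N[q] (inj₂ (∼-sym G (subst₂ (_∼[ G ]_) c≡w d≡q c∼d)))
      impossible _   (inj₂ (inj₂ (_ , p∼d , hw∼hd))) = none (_ , p∼d , hw∼hd)

      packs : ∀ c d → c ∼[ G ] d → ¬ h (transpose p w c) ∼[ F ] h (transpose p w d)
      packs c d c∼d conflict with transposed-conflict w c d c∼d conflict
      ... | inj₁ cd = impossible c∼d cd
      ... | inj₂ dc = impossible (∼-sym G c∼d) dc

    image-N⟨p⟩ image-N[q] coverList : List (Fin n)
    image-N⟨p⟩ = map h (neighbours G p)
    image-N[q] = map h (q ∷ neighbours G q)
    coverList  = image-N[q] ++ concatMap (neighbours F) image-N⟨p⟩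

    hits-from-N⟨p⟩ : Fin n → ℕ
    hits-from-N⟨p⟩ y = ∑ (λ z → multiplicity y (neighbours F z)) image-N⟨p⟩

    multiplicity-coverList : ∀ y → multiplicity y coverList ≡ multiplicity y image-N[q] + hits-from-N⟨p⟩ y
    multiplicity-coverList y =
      trans (∑-++ (δ y) image-N[q] _) (cong (multiplicity y image-N[q] +_) (∑-concatMap (δ y) (neighbours F) image-N⟨p⟩))

    occurs-in-image-N[q] : ∀ {w} → (N[ G ] q) w → 1 ≤ multiplicity (h w) image-N[q]
    occurs-in-image-N[q] (inj₁ refl) = multiplicity-∈ {xs = image-N[q]} (here refl)
    occurs-in-image-N[q] (inj₂ q∼w)  = multiplicity-∈ {xs = image-N[q]} (there (∈-map⁺ h (∈-neighbours⁺ G q∼w)))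

    ∈-image-N⟨p⟩ : ∀ {a} → p ∼[ G ] a → h a ∈ image-N⟨p⟩
    ∈-image-N⟨p⟩ p∼a = ∈-map⁺ h (∈-neighbours⁺ G p∼a)

    hits-from-N⟨p⟩≥1 : ∀ {a y} → p ∼[ G ] a → h a ∼[ F ] y → 1 ≤ hits-from-N⟨p⟩ y
    hits-from-N⟨p⟩≥1 p∼a ha∼y =
      ≤-trans (multiplicity-∈ (∈-neighbours⁺ F ha∼y)) (∑-≥-term _ (∈-image-N⟨p⟩ p∼a))

    hits-from-N⟨p⟩≥2 : ∀ {a a′ y} → p ∼[ G ] a → p ∼[ G ] a′ → a ≢ a′ → h a ∼[ F ] y → h a′ ∼[ F ] y → 2 ≤ hits-from-N⟨p⟩ y
    hits-from-N⟨p⟩≥2 p∼a p∼a′ a≢a′ ha∼y ha′∼y =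
      ≤-trans (+-mono-≤ (multiplicity-∈ (∈-neighbours⁺ F ha∼y)) (multiplicity-∈ (∈-neighbours⁺ F ha′∼y)))
              (∑-≥-two-terms _ (∈-image-N⟨p⟩ p∼a) (∈-image-N⟨p⟩ p∼a′) (a≢a′ ∘ h-injective))

    covers : ∀ y → 1 ≤ multiplicity y coverList
    covers y = subst (λ v → 1 ≤ multiplicity v coverList) (h∘h⁻¹ y) (covers-image (h⁻¹ y))
      where
      covers-image : ∀ w → 1 ≤ multiplicity (h w) coverList
      covers-image w rewrite multiplicity-coverList (h w) with closed-neighbourhood? G q w
      ... | yes w∈N[q] = ≤-trans (occurs-in-image-N[q] w∈N[q]) (m≤m+n _ _)
      ... | no  w∉N[q] with outside-N[q]⇒F-adjacent-to-N⟨p⟩ w∉N[q]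
      ...   | _ , p∼a , hw∼ha = ≤-trans (hits-from-N⟨p⟩≥1 p∼a (∼-sym F hw∼ha)) (m≤n+m _ _)

    coverList-length : length coverList ≡ suc (deg G q) + ∑ (deg F) image-N⟨p⟩
    coverList-length = trans (length-++ image-N[q])
      (cong₂ _+_ (length-map h (q ∷ neighbours G q)) (length-concatMap (neighbours F) image-N⟨p⟩))

    deficit excess : ℕ
    deficit = ∑ (λ v → 2 ∸ deg F v) image-N⟨p⟩
    excess  = ∑ (λ v → multiplicity v coverList ∸ 1) (allFin n)

    coverList-length+deficit≤ : length coverList + deficit ≤ suc n
    coverList-length+deficit≤ = begin
      length coverList + deficit                          ≡⟨ cong (_+ deficit) coverList-length ⟩
      suc (deg G q) + ∑ (deg F) image-N⟨p⟩ + deficit      ≡⟨ +-assoc (suc (deg G q)) _ deficit ⟩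
      suc (deg G q) + (∑ (deg F) image-N⟨p⟩ + deficit)    ≤⟨ +-monoʳ-≤ (suc (deg G q))
                                                              (∑-deg+∑-deficit≤ F (Unique.map⁺ h-injective (neighbours-unique G p))) ⟩
      suc (deg G q) + (2 * length image-N⟨p⟩ + ℓ* F)      ≡⟨ cong (λ k → suc (deg G q) + (2 * k + ℓ* F)) (length-map h (neighbours G p)) ⟩
      suc (deg G q) + (2 * deg G p + ℓ* F)                ≤⟨ s≤s (+-mono-≤ (deg≤Δ G q) (+-monoˡ-≤ (ℓ* F) (*-monoʳ-≤ 2 (deg≤Δ G p)))) ⟩
      suc (Δ G + (2 * Δ G + ℓ* F))                        ≡⟨ cong suc (trans (sym (+-assoc (Δ G) _ (ℓ* F))) tight) ⟩
      suc n                                               ∎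
      where open ≤-Reasoning

    excess+deficit≤1 : excess + deficit ≤ 1
    excess+deficit≤1 = +-cancelˡ-≤ n _ 1 (begin
      n + (excess + deficit)      ≡⟨ sym (+-assoc n excess deficit) ⟩
      n + excess + deficit        ≡⟨ cong (_+ deficit) (sym (covering-length coverList covers)) ⟩
      length coverList + deficit  ≤⟨ coverList-length+deficit≤ ⟩
      suc n                       ≡⟨ +-comm 1 n ⟩
      n + 1                       ∎)
      where open ≤-Reasoning

    hp-repeated : 2 ≤ multiplicity (h p) coverList
    hp-repeated = subst (2 ≤_) (sym (multiplicity-coverList (h p)))
      (+-mono-≤ (occurs-in-image-N[q] (inj₂ (∼-sym G p∼q))) (hits-from-N⟨p⟩≥1 p∼q (∼-sym F hp∼hq)))

    excess≥1 : 1 ≤ excess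
    excess≥1 = ≤-trans (∸-monoˡ-≤ 1 hp-repeated) (∑-≥-term _ (∈-allFin (h p)))

    only-hp-repeated : ∀ {y} → y ≢ h p → ¬ 2 ≤ multiplicity y coverList
    only-hp-repeated {y} y≢hp 2≤y = 1+n≰n (≤-trans excess≥2 (≤-trans (m≤m+n excess deficit) excess+deficit≤1))
      where
      excess≥2 : 2 ≤ excess
      excess≥2 = ≤-trans (+-mono-≤ (∸-monoˡ-≤ 1 hp-repeated) (∸-monoˡ-≤ 1 2≤y))
        (∑-≥-two-terms (λ v → multiplicity v coverList ∸ 1) (∈-allFin (h p)) (∈-allFin y) (y≢hp ∘ sym))

    no-F-edge-N[q]-N⟨p⟩ : ∀ {w a} → (N[ G ] q) w → w ≢ p → p ∼[ G ] a → ¬ h w ∼[ F ] h a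
    no-F-edge-N[q]-N⟨p⟩ {w} w∈N[q] w≢p p∼a hw∼ha = only-hp-repeated (w≢p ∘ h-injective)
      (subst (2 ≤_) (sym (multiplicity-coverList (h w))) (+-mono-≤ (occurs-in-image-N[q] w∈N[q]) (hits-from-N⟨p⟩≥1 p∼a (∼-sym F hw∼ha))))

    no-common-F-neighbour : ∀ {a a′ r} → p ∼[ G ] a → p ∼[ G ] a′ → a ≢ a′ →
      h r ∼[ F ] h a → h r ∼[ F ] h a′ → ⊥
    no-common-F-neighbour {a} {a′} {r} p∼a p∼a′ a≢a′ hr∼ha hr∼ha′ = only-hp-repeated hr≢hp
      (subst (2 ≤_) (sym (multiplicity-coverList (h r)))
        (≤-trans (hits-from-N⟨p⟩≥2 p∼a p∼a′ a≢a′ (∼-sym F hr∼ha) (∼-sym F hr∼ha′)) (m≤n+m (hits-from-N⟨p⟩ (h r)) _)))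
      where
      hr≢hp : h r ≢ h p
      hr≢hp hr≡hp = a≢a′ (trans (hp∼h⇒≡q (subst (_∼[ F ] h a) hr≡hp hr∼ha))
                            (sym (hp∼h⇒≡q (subst (_∼[ F ] h a′) hr≡hp hr∼ha′))))

    image-N⟨p⟩-non-leaf : ∀ {a} → p ∼[ G ] a → 2 ≤ deg F (h a)
    image-N⟨p⟩-non-leaf p∼a = m∸n≡0⇒m≤n (n≤0⇒n≡0 (+-cancelˡ-≤ 1 _ 0
      (≤-trans (+-mono-≤ excess≥1 (∑-≥-term (λ v → 2 ∸ deg F v) (∈-image-N⟨p⟩ p∼a))) excess+deficit≤1)))

    transposed-quasipacking : ∀ {w} → (N[ G ] q) w → w ≢ p →
      QuasipackingWithConflict G F (h ∘ transpose p w) w (transpose p w q)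
    transposed-quasipacking {w} w∈N[q] w≢p =
      ∘transpose-bijective p w h-bijective , w∼τq , hτw∼hττq , only
      where
      τ : Fin n → Fin n
      τ = transpose p w

      w∼τq : w ∼[ G ] τ q
      w∼τq with τ q | transpose-view p w q
      ... | _ | at-i q≡p          = ⊥-elim (p≢q (sym q≡p))
      ... | _ | at-j _ q≡w        = subst (_∼[ G ] p) q≡w (∼-sym G p∼q)
      ... | _ | elsewhere _ q≢w   = [ (λ w≡q → ⊥-elim (q≢w (sym w≡q))) , ∼-sym G ] w∈N[q]

      hτw∼hττq : h (τ w) ∼[ F ] h (τ (τ q))
      hτw∼hττq = subst₂ (λ s t → h s ∼[ F ] h t) (sym (transpose-j p w)) (sym (transpose-involutive p w q)) hp∼hq

      resolve : ∀ {c d} → c ∼[ G ] d → TransposedConflict w c d → (c ≡ w × d ≡ τ q) ⊎ (c ≡ τ q × d ≡ w)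
      resolve _   (inj₁ (c≡p , d≡w , w≡q)) =
        inj₂ (trans c≡p (sym (trans (cong τ (sym w≡q)) (transpose-j p w))) , d≡w)
      resolve c∼d (inj₂ (inj₁ (c≡w , d≡q))) =
        inj₁ (c≡w , trans d≡q (sym (transpose-elsewhere p w (p≢q ∘ sym) q≢w)))
        where
        q≢w : q ≢ w
        q≢w q≡w = ∼⇒≢ G c∼d (trans c≡w (trans (sym q≡w) (sym d≡q)))
      resolve _   (inj₂ (inj₂ (_ , p∼d , hw∼hd))) = ⊥-elim (no-F-edge-N[q]-N⟨p⟩ w∈N[q] w≢p p∼d hw∼hd)

      only : ∀ c d → c ∼[ G ] d → h (τ c) ∼[ F ] h (τ d) → (c ≡ w × d ≡ τ q) ⊎ (c ≡ τ q × d ≡ w)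
      only c d c∼d conflict with transposed-conflict w c d c∼d conflict
      ... | inj₁ cd = resolve c∼d cd
      ... | inj₂ dc = Sum.swap (Sum.map Product.swap Product.swap (resolve (∼-sym G c∼d) dc))

    transposed-leaf : ∀ w → deg F (h (transpose p w w)) ≡ 1
    transposed-leaf w = subst (λ v → deg F (h v) ≡ 1) (sym (transpose-j p w)) leaf

  module ClosedNeighbourhoods (forest : Forest F) (h : Fin n → Fin n) (p q : Fin n)
                              (qp : QuasipackingWithConflict G F h p q) (leaf : deg F (h p) ≡ 1) where
    open LeafConflict h p q qp leaf

    h′ : Fin n → Fin n
    h′ = h ∘ transpose p q

    module Swapped = LeafConflict h′ q p
      (subst (QuasipackingWithConflict G F h′ q) (transpose-j p q) (transposed-quasipacking (inj₁ refl) (p≢q ∘ sym)))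
      (transposed-leaf q)

    h′p≡hq : h′ p ≡ h q
    h′p≡hq = cong h (transpose-i p q)

    h′≡h : ∀ {v} → v ≢ p → v ≢ q → h′ v ≡ h v
    h′≡h v≢p v≢q = cong h (transpose-elsewhere p q v≢p v≢q)

    F-edge-via-h′ : ∀ {v w} → v ≢ p → v ≢ q → w ≢ p → w ≢ q → h v ∼[ F ] h w → h′ v ∼[ F ] h′ w
    F-edge-via-h′ v≢p v≢q w≢p w≢q = subst₂ (_∼[ F ]_) (sym (h′≡h v≢p v≢q)) (sym (h′≡h w≢p w≢q))

    OnlyP OnlyQ Far : Fin n → Set
    OnlyP v = p ∼[ G ] v × ¬ (N[ G ] q) v
    OnlyQ v = q ∼[ G ] v × ¬ (N[ G ] p) v
    Far   v = ¬ (N[ G ] q) v × ¬ (N[ G ] p) v × ¬ h v ∼[ F ] h q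

    -- A Link can always be continued without backtracking (Link-extends), so there is none in
    -- the forest F; the endless walk starting from a vertex of OnlyP or OnlyQ then shows both empty.
    Link : Fin n → Fin n → Set
    Link v w = h v ∼[ F ] h w ×
      (OnlyP v × (OnlyP w ⊎ Far w) ⊎ Far v × (OnlyP w ⊎ OnlyQ w) ⊎ OnlyQ v × (OnlyQ w ⊎ Far w))

    OnlyP-F-neighbour : ∀ {v r} → OnlyP v → h v ∼[ F ] h r → OnlyP r ⊎ Far r
    OnlyP-F-neighbour {v} {r} (p∼v , v∉N[q]) hv∼hr =
      Sum.map (_, r∉N[q]) (λ ¬p∼r → r∉N[q] , [ r≢p , ¬p∼r ] , hr≁hq) (toSum (adjacent? G p r))
      where
      r≢p : r ≢ p
      r≢p r≡p = v∉N[q] (inj₁ (hp∼h⇒≡q (subst (λ t → h t ∼[ F ] h v) r≡p (∼-sym F hv∼hr))))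
      r∉N[q] : ¬ (N[ G ] q) r
      r∉N[q] r∈N[q] = no-F-edge-N[q]-N⟨p⟩ r∈N[q] r≢p p∼v (∼-sym F hv∼hr)
      hr≁hq : ¬ h r ∼[ F ] h q
      hr≁hq = no-common-F-neighbour {r = r} p∼v p∼q (v∉N[q] ∘ inj₁) (∼-sym F hv∼hr)

    OnlyQ-F-neighbour : ∀ {v r} → OnlyQ v → h v ∼[ F ] h r → OnlyQ r ⊎ Far r
    OnlyQ-F-neighbour {v} {r} (q∼v , v∉N[p]) hv∼hr =
      Sum.map (_, r∉N[p]) (λ ¬q∼r → [ r≢q , ¬q∼r ] , r∉N[p] , hr≁hq) (toSum (adjacent? G q r))
      where
      v≢p : v ≢ p
      v≢p = v∉N[p] ∘ inj₁
      v≢q : v ≢ q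
      v≢q = ∼⇒≢ G q∼v ∘ sym
      r≢p : r ≢ p
      r≢p r≡p = v≢q (hp∼h⇒≡q (subst (λ t → h t ∼[ F ] h v) r≡p (∼-sym F hv∼hr)))
      r≢q : r ≢ q
      r≢q r≡q = Swapped.no-F-edge-N[q]-N⟨p⟩ (inj₁ refl) p≢q q∼v
        (subst₂ (_∼[ F ]_) (sym h′p≡hq) (sym (h′≡h v≢p v≢q)) (subst (λ t → h t ∼[ F ] h v) r≡q (∼-sym F hv∼hr)))
      r∉N[p] : ¬ (N[ G ] p) r
      r∉N[p] r∈N[p] = Swapped.no-F-edge-N[q]-N⟨p⟩ r∈N[p] r≢q q∼v (F-edge-via-h′ r≢p r≢q v≢p v≢q (∼-sym F hv∼hr))
      hr≁hq : ¬ h r ∼[ F ] h q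
      hr≁hq hr∼hq = Swapped.no-common-F-neighbour {r = r} q∼v (∼-sym G p∼q) v≢p
        (F-edge-via-h′ r≢p r≢q v≢p v≢q (∼-sym F hv∼hr)) (subst₂ (_∼[ F ]_) (sym (h′≡h r≢p r≢q)) (sym h′p≡hq) hr∼hq)

    Far-after-OnlyP : ∀ {r v} → Far r → OnlyP v → h r ∼[ F ] h v → ∃[ s ] OnlyQ s × h r ∼[ F ] h s
    Far-after-OnlyP {r} {v} (r∉N[q] , r∉N[p] , hr≁hq) (p∼v , v∉N[q]) hr∼hv
      with Swapped.outside-N[q]⇒F-adjacent-to-N⟨p⟩ r∉N[p]
    ... | b , q∼b , h′r∼h′b = b , (q∼b , [ b≢p , ¬p∼b ]) , hr∼hb
      where
      r≢p : r ≢ p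
      r≢p = r∉N[p] ∘ inj₁
      r≢q : r ≢ q
      r≢q = r∉N[q] ∘ inj₁
      b≢q : b ≢ q
      b≢q = ∼⇒≢ G q∼b ∘ sym
      b≢p : b ≢ p
      b≢p b≡p = hr≁hq (subst₂ (_∼[ F ]_) (h′≡h r≢p r≢q) (trans (cong h′ b≡p) h′p≡hq) h′r∼h′b)
      hr∼hb : h r ∼[ F ] h b
      hr∼hb = subst₂ (_∼[ F ]_) (h′≡h r≢p r≢q) (h′≡h b≢p b≢q) h′r∼h′b
      ¬p∼b : ¬ p ∼[ G ] b
      ¬p∼b p∼b = no-common-F-neighbour {r = r} p∼v p∼b (λ v≡b → v∉N[q] (inj₂ (subst (q ∼[ G ]_) (sym v≡b) q∼b))) hr∼hv hr∼hb

    Far-after-OnlyQ : ∀ {r s} → Far r → OnlyQ s → h r ∼[ F ] h s → ∃[ a ] OnlyP a × h r ∼[ F ] h a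
    Far-after-OnlyQ {r} {s} (r∉N[q] , r∉N[p] , hr≁hq) (q∼s , s∉N[p]) hr∼hs
      with outside-N[q]⇒F-adjacent-to-N⟨p⟩ r∉N[q]
    ... | a , p∼a , hr∼ha = a , (p∼a , [ a≢q , ¬q∼a ]) , hr∼ha
      where
      a≢q : a ≢ q
      a≢q a≡q = hr≁hq (subst (λ t → h r ∼[ F ] h t) a≡q hr∼ha)
      ¬q∼a : ¬ q ∼[ G ] a
      ¬q∼a q∼a = Swapped.no-common-F-neighbour {r = r} q∼a q∼s (λ a≡s → s∉N[p] (inj₂ (subst (p ∼[ G ]_) a≡s p∼a)))
        (F-edge-via-h′ (r∉N[p] ∘ inj₁) (r∉N[q] ∘ inj₁) (∼⇒≢ G p∼a ∘ sym) a≢q hr∼ha)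
        (F-edge-via-h′ (r∉N[p] ∘ inj₁) (r∉N[q] ∘ inj₁) (s∉N[p] ∘ inj₁) (∼⇒≢ G q∼s ∘ sym) hr∼hs)

    OnlyP⇒¬OnlyQ : ∀ {v} → OnlyP v → ¬ OnlyQ v
    OnlyP⇒¬OnlyQ (_ , v∉N[q]) (q∼v , _) = v∉N[q] (inj₂ q∼v)

    continue-from-OnlyP : ∀ {v} → OnlyP v → ∀ w → ∃[ v′ ] Link v v′ × v′ ≢ w
    continue-from-OnlyP pv w =
      let v′ , hv∼hv′ , v′≢w = F-neighbour-avoiding (image-N⟨p⟩-non-leaf (proj₁ pv)) w
      in  v′ , (hv∼hv′ , inj₁ (pv , OnlyP-F-neighbour pv hv∼hv′)) , v′≢w

    OnlyQ-non-leaf : ∀ {v} → OnlyQ v → 2 ≤ deg F (h v)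
    OnlyQ-non-leaf (q∼v , v∉N[p]) =
      subst (λ t → 2 ≤ deg F t) (h′≡h (v∉N[p] ∘ inj₁) (∼⇒≢ G q∼v ∘ sym)) (Swapped.image-N⟨p⟩-non-leaf q∼v)

    continue-from-OnlyQ : ∀ {v} → OnlyQ v → ∀ w → ∃[ v′ ] Link v v′ × v′ ≢ w
    continue-from-OnlyQ qv w =
      let v′ , hv∼hv′ , v′≢w = F-neighbour-avoiding (OnlyQ-non-leaf qv) w
      in  v′ , (hv∼hv′ , inj₂ (inj₂ (qv , OnlyQ-F-neighbour qv hv∼hv′))) , v′≢w

    Link-extends : ∀ {w v} → Link w v → ∃[ v′ ] Link v v′ × v′ ≢ w
    Link-extends {w} (_ , inj₁ (_ , inj₁ pv))           = continue-from-OnlyP pv w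
    Link-extends {w} (_ , inj₂ (inj₁ (_ , inj₁ pv)))    = continue-from-OnlyP pv w
    Link-extends {w} (_ , inj₂ (inj₁ (_ , inj₂ qv)))    = continue-from-OnlyQ qv w
    Link-extends {w} (_ , inj₂ (inj₂ (_ , inj₁ qv)))    = continue-from-OnlyQ qv w
    Link-extends (hw∼hv , inj₁ (pw , inj₂ fv)) =
      let s , qs , hv∼hs = Far-after-OnlyP fv pw (∼-sym F hw∼hv)
      in  s , (hv∼hs , inj₂ (inj₁ (fv , inj₂ qs))) , λ s≡w → OnlyP⇒¬OnlyQ pw (subst OnlyQ s≡w qs)
    Link-extends (hw∼hv , inj₂ (inj₂ (qw , inj₂ fv))) =
      let a , pa , hv∼ha = Far-after-OnlyQ fv qw (∼-sym F hw∼hv)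
      in  a , (hv∼ha , inj₂ (inj₁ (fv , inj₁ pa))) , λ a≡w → OnlyP⇒¬OnlyQ pa (subst OnlyQ (sym a≡w) qw)

    no-Link : ∀ {v w} → ¬ Link v w
    no-Link v→w = forest (map-cycle F h-injective (nonBacktracking⇒Cycle (pullback F h) Link proj₁ Link-extends v→w))

    N[p]⊆N[q] : N[ G ] p ⊆′ N[ G ] q
    N[p]⊆N[q] _ (inj₁ refl) = inj₂ (∼-sym G p∼q)
    N[p]⊆N[q] w (inj₂ p∼w)  = decidable-stable (closed-neighbourhood? G q w)
      λ w∉N[q] → no-Link (proj₁ (proj₂ (continue-from-OnlyP (p∼w , w∉N[q]) w)))

    N[q]⊆N[p] : N[ G ] q ⊆′ N[ G ] p
    N[q]⊆N[p] _ (inj₁ refl) = inj₂ p∼q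
    N[q]⊆N[p] w (inj₂ q∼w)  = decidable-stable (closed-neighbourhood? G p w)
      λ w∉N[p] → no-Link (proj₁ (proj₂ (continue-from-OnlyQ (q∼w , w∉N[p]) w)))

  closed-neighbourhoods-coincide : Forest F → ∀ h p q → QuasipackingWithConflict G F h p q → deg F (h p) ≡ 1 →
    N[ G ] p ⊆′ N[ G ] q × N[ G ] q ⊆′ N[ G ] p
  closed-neighbourhoods-coincide forest h p q qp leaf = N[p]⊆N[q] , N[q]⊆N[p]
    where open ClosedNeighbourhoods forest h p q qp leaf

  -- Every other neighbour a of p can take over the leaf end of the conflict, via h ∘ (p a).
  closed-neighbourhoods-uniform : Forest F → ∀ h p q → QuasipackingWithConflict G F h p q → deg F (h p) ≡ 1 →
    ∀ a → (N[ G ] p) a → N[ G ] p ⊆′ N[ G ] a × N[ G ] a ⊆′ N[ G ] p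
  closed-neighbourhoods-uniform forest h p q qp leaf a (inj₁ refl) = (λ _ → id) , (λ _ → id)
  closed-neighbourhoods-uniform forest h p q qp leaf a (inj₂ p∼a) with a ≟ q
  ... | yes refl = closed-neighbourhoods-coincide forest h p q qp leaf
  ... | no  a≢q  = (λ w → proj₂ a-side w ∘ proj₁ p-side w) , (λ w → proj₂ p-side w ∘ proj₁ a-side w)
    where
    open LeafConflict h p q qp leaf
    p-side : N[ G ] p ⊆′ N[ G ] q × N[ G ] q ⊆′ N[ G ] p
    p-side = closed-neighbourhoods-coincide forest h p q qp leaf
    q∼a : q ∼[ G ] a
    q∼a = [ (λ a≡q → ⊥-elim (a≢q a≡q)) , id ] (proj₁ p-side a (inj₂ p∼a))
    a-side : N[ G ] a ⊆′ N[ G ] q × N[ G ] q ⊆′ N[ G ] a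
    a-side = closed-neighbourhoods-coincide forest (h ∘ transpose p a) a q
      (subst (QuasipackingWithConflict G F (h ∘ transpose p a) a) (transpose-elsewhere p a (p≢q ∘ sym) (a≢q ∘ sym))
             (transposed-quasipacking (inj₂ q∼a) (∼⇒≢ G p∼a ∘ sym)))
      (transposed-leaf a)

module _ {n : ℕ} (H : Graph n) {u : Fin n}
         (uniform : ∀ a → (N[ H ] u) a → N[ H ] u ⊆′ N[ H ] a × N[ H ] a ⊆′ N[ H ] u) where

  closed-neighbourhood-complete : CompleteOn H (N[ H ] u)
  closed-neighbourhood-complete a b a∈N[u] b∈N[u] a≢b =
    [ (λ b≡a → ⊥-elim (a≢b (sym b≡a))) , id ] (proj₁ (uniform a a∈N[u]) b b∈N[u])

  closed-neighbourhood-component : IsComponent H (N[ H ] u)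
  closed-neighbourhood-component = (u , inj₁ refl) , walk , λ a b a∈N[u] a∼b → proj₂ (uniform a a∈N[u]) b (inj₂ a∼b)
    where
    walk : ∀ a b → (N[ H ] u) a → (N[ H ] u) b → WalkIn H (N[ H ] u) a b
    walk a b a∈N[u] b∈N[u] with a ≟ b
    ... | yes refl = here a a∈N[u]
    ... | no  a≢b  = next a b b a∈N[u] (closed-neighbourhood-complete a b a∈N[u] b∈N[u] a≢b) (here b b∈N[u])

lemma2p2 : (n : ℕ) (G F : Graph n) → Forest F → EdgeMinimalNonPacking G F →
    3 * Δ G + ℓ* F ≡ n → 1 < Δ G →
    (u' x' : Fin n) → deg F u' ≡ 1 → u' ∼[ F ] x' →
    (f : Fin n → Fin n) (u x : Fin n) → QuasipackingWithConflict G F f u x →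
    f u ≡ u' → f x ≡ x' →
    (∀ w → (N[ G ] u) w → (N[ G ] x) w) × (∀ w → (N[ G ] x) w → (N[ G ] u) w) ×
    CompleteOn G (N[ G ] u) × IsComponent G (N[ G ] u)
lemma2p2 n G F forest (¬packs , _) tight _ _ _ leaf _ f u x qp refl _ =
  proj₁ N[u]≐N[x] , proj₂ N[u]≐N[x] , closed-neighbourhood-complete G uniform , closed-neighbourhood-component G uniform
  where
  N[u]≐N[x] : N[ G ] u ⊆′ N[ G ] x × N[ G ] x ⊆′ N[ G ] u
  N[u]≐N[x] = closed-neighbourhoods-coincide G F ¬packs tight forest f u x qp leaf

  uniform : ∀ a → (N[ G ] u) a → N[ G ] u ⊆′ N[ G ] a × N[ G ] a ⊆′ N[ G ] u
  uniform = closed-neighbourhoods-uniform G F ¬packs tight forest f u x qp leaf
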